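{- In intensional Martin-Löf type theory (without function extensionality and without propositional truncation), if every type has a constant endofunction, then every type has decidable equality: $$\Big(\prod_{X:\mathcal U}\sum_{f:X\to X}\prod_{x,y:X}f(x)=f(y)\Big)\to\prod_{X:\mathcal U}\prod_{x,y:X}\big((x=y)+\neg(x=y)\big).$$
   Context: Intensional Martin-Löf type theory with a universe $\mathcal U$ (and a larger universe containing it as needed), $\Sigma$, $\Pi$, $+$, empty type $\mathbf 0$, the booleans $\mathbf 2$, and identity types (J only; no UIP/K). $\neg A:\equiv A\to\mathbf 0$. -}

{-# OPTIONS --without-K #-}
module Defs where

open import Data.Product using (Σ)
open import Relation.Binary.PropositionalEquality using (_≡_)

constant : {X : Set} → (X → X) → Set
constant {X} f = (x y : X) → f x ≡ f y

AllTypesHaveConstEndo : Set₁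
AllTypesHaveConstEndo = (X : Set) → Σ (X → X) (λ f → constant f)

{-# OPTIONS --without-K #-}
-- Given x y : X, consider the map 2 → X picking out x and y. A constant
-- endofunction on each fibre of this map chooses, for every point in its image,
-- a boolean in the preimage, and constancy makes this choice depend only on the
-- point. So the choices for true and false agree exactly when x ≡ y, and
-- equality of booleans is decidable.
module Submission where

open import Defs
open import Data.Sum using (_⊎_)
open import Data.Product using (Σ; _,_; proj₁; proj₂)
open import Data.Bool using (Bool; true; false; if_then_else_)
open import Data.Bool.Properties using () renaming (_≟_ to _≟ᵇ_)
open import Relation.Nullary using (¬_; Dec)
open import Relation.Nullary.Decidable using (map′; toSum)
open import Relation.Binary.Definitions using (DecidableEquality)
open import Relation.Binary.PropositionalEquality using (_≡_; refl; sym; trans; cong)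

fibre : {A X : Set} → (A → X) → X → Set
fibre {A} p u = Σ A (λ a → p a ≡ u)

module ConstantChoiceOnFibres
  {A X : Set} (p : A → X)
  (k : (u : X) → fibre p u → fibre p u)
  (k-constant : (u : X) → constant (k u))
  where

  choice : A → A
  choice a = proj₁ (k (p a) (a , refl))

  p∘choice≡p : (a : A) → p (choice a) ≡ p a
  p∘choice≡p a = proj₂ (k (p a) (a , refl))

  choice-transport : (b : A) {u : X} (q : p b ≡ u) → proj₁ (k u (b , q)) ≡ choice b
  choice-transport b refl = refl

  choice-respects-p : (a b : A) → p a ≡ p b → choice a ≡ choice b
  choice-respects-p a b e =
    trans (cong proj₁ (k-constant (p a) (a , refl) (b , sym e))) (choice-transport b (sym e))

  choice-reflects-p : (a b : A) → choice a ≡ choice b → p a ≡ p b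
  choice-reflects-p a b e = trans (sym (p∘choice≡p a)) (trans (cong p e) (p∘choice≡p b))

  image-dec-≡ : DecidableEquality A → (a b : A) → Dec (p a ≡ p b)
  image-dec-≡ _≟_ a b = map′ (choice-reflects-p a b) (choice-respects-p a b) (choice a ≟ choice b)

theorem7p2 : ((X : Set) → Σ (X → X) (λ f → (x y : X) → f x ≡ f y)) → (X : Set) → (x y : X) → (x ≡ y) ⊎ ¬ (x ≡ y)
theorem7p2 H X x y = toSum (image-dec-≡ _≟ᵇ_ true false)
  where
  pick : Bool → X
  pick b = if b then x else y

  open ConstantChoiceOnFibres pick (λ u → proj₁ (H (fibre pick u))) (λ u → proj₂ (H (fibre pick u)))
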